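{- Let $G$ and $J$ be graphs, let $\mathcal{C}$ be a set of connected induced subgraphs of $G$, and let $H=H(G,\mathcal{C})$. Suppose that (i) $G$ is $J$-free, (ii) $J$ has no true twins, and (iii) the class of $J$-free graphs is closed under edge contraction. Then $H$ is $J$-free.
   Context: A graph is $J$-free if it has no induced subgraph isomorphic to $J$. Two vertices $u,v$ are true twins if $uv$ is an edge and $N(u)\setminus\{v\}=N(v)\setminus\{u\}$. Edge contraction of $uv$: delete $u,v$ and add a new vertex adjacent to $(N(u)\cup N(v))\setminus\{u,v\}$. The graph $H(G,\mathcal{C})$ has vertex set $\{v_C: C\in\mathcal{C}\}$, and $v_Cv_{C'}$ (for distinct $C,C'\in\mathcal{C}$) is an edge if and only if $V(C)\cap V(C')\neq\emptyset$ or some vertex of $C$ is adjacent in $G$ to some vertex of $C'$. -}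

module Defs where

open import Data.Nat using (ℕ; zero; suc)
open import Data.Fin using (Fin; zero; suc; punchIn; punchOut)
open import Data.Fin.Subset using (Subset; _∈_)
open import Data.Product using (Σ; ∃; ∃-syntax; _×_; _,_)
open import Data.Sum using (_⊎_; inj₁; inj₂)
open import Data.Empty using (⊥; ⊥-elim)
open import Relation.Nullary using (¬_)
open import Relation.Binary.PropositionalEquality using (_≡_; _≢_; refl)
open import Function using (_⇔_)
open import Function.Definitions using (Injective)
open import Level using (0ℓ)

record Graph : Set₁ where
  constructor mkGraph
  field
    n      : ℕ
    E      : Fin n → Fin n → Set
    sym    : ∀ {x y} → E x y → E y x
    irrefl : ∀ {x} → ¬ E x x

open Graph public

InducedSubgraph : Graph → Graph → Set
InducedSubgraph J G =
  Σ (Fin (n J) → Fin (n G)) λ f →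
    Injective _≡_ _≡_ f × (∀ x y → E J x y ⇔ E G (f x) (f y))

Free : Graph → Graph → Set
Free J G = ¬ InducedSubgraph J G

TrueTwins : (J : Graph) → Fin (n J) → Fin (n J) → Set
TrueTwins J u v =
  E J u v × (∀ w → w ≢ u → w ≢ v → (E J u w ⇔ E J v w))

NoTrueTwins : Graph → Set
NoTrueTwins J = ∀ u v → ¬ TrueTwins J u v

edge⇒≢ : (K : Graph) {u v : Fin (n K)} → E K u v → u ≢ v
edge⇒≢ K e refl = irrefl K e

-- Contraction of the edge uv in a graph on Fin (2+m):
-- vertex zero is the new vertex, vertex (suc i) is the i-th vertex of K other than u, v.
module _ (m : ℕ) (E₀ : Fin (suc (suc m)) → Fin (suc (suc m)) → Set)
         (sym₀ : ∀ {x y} → E₀ x y → E₀ y x)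
         (u v : Fin (suc (suc m))) (u≢v : u ≢ v) where

  rest : Fin m → Fin (suc (suc m))
  rest i = punchIn u (punchIn (punchOut u≢v) i)

  cE : Fin (suc m) → Fin (suc m) → Set
  cE zero    zero    = ⊥
  cE zero    (suc j) = E₀ u (rest j) ⊎ E₀ v (rest j)
  cE (suc i) zero    = E₀ u (rest i) ⊎ E₀ v (rest i)
  cE (suc i) (suc j) = E₀ (rest i) (rest j)

  cSym : ∀ {x y} → cE x y → cE y x
  cSym {zero}  {zero}  ()
  cSym {zero}  {suc j} e = e
  cSym {suc i} {zero}  e = e
  cSym {suc i} {suc j} e = sym₀ e

contractAux : ∀ m (E₀ : Fin (suc (suc m)) → Fin (suc (suc m)) → Set)
  → (∀ {x y} → E₀ x y → E₀ y x) → (∀ {x} → ¬ E₀ x x)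
  → (u v : Fin (suc (suc m))) → u ≢ v → Graph
contractAux m E₀ s i u v p = mkGraph (suc m) (cE m E₀ s u v p) (λ {x} {y} → cSym m E₀ s u v p {x} {y}) (λ {x} → irr x)
  where
  irr : ∀ x → ¬ cE m E₀ s u v p x x
  irr zero    ()
  irr (suc x) e = i e

Contract : (K : Graph) (u v : Fin (n K)) → u ≢ v → Graph
Contract (mkGraph zero E₀ s i) () v p
Contract (mkGraph (suc zero) E₀ s i) zero zero p = ⊥-elim (p refl)
Contract (mkGraph (suc (suc m)) E₀ s i) u v p = contractAux m E₀ s i u v p

FreeClosedUnderContraction : Graph → Set₁
FreeClosedUnderContraction J =
  ∀ (K : Graph) → Free J K → ∀ u v → (e : E K u v) → Free J (Contract K u v (edge⇒≢ K e))

data Reach (G : Graph) (S : Subset (n G)) : Fin (n G) → Fin (n G) → Set where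
  here : ∀ {x} → Reach G S x x
  step : ∀ {x y z} → E G x y → y ∈ S → Reach G S y z → Reach G S x z

ConnectedInduced : (G : Graph) → Subset (n G) → Set
ConnectedInduced G S =
  (∃[ x ] x ∈ S) × (∀ x y → x ∈ S → y ∈ S → Reach G S x y)

record Family (G : Graph) : Set where
  constructor mkFamily
  field
    k        : ℕ
    C        : Fin k → Subset (n G)
    distinct : Injective _≡_ _≡_ C
    conn     : ∀ i → ConnectedInduced G (C i)

open Family public

HE : (G : Graph) (𝒞 : Family G) → Fin (k 𝒞) → Fin (k 𝒞) → Set
HE G 𝒞 i j = i ≢ j ×
  ((∃[ x ] (x ∈ C 𝒞 i × x ∈ C 𝒞 j))
   ⊎ (∃[ x ] ∃[ y ] (x ∈ C 𝒞 i × y ∈ C 𝒞 j × E G x y)))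

HE-sym : (G : Graph) (𝒞 : Family G) → ∀ {i j} → HE G 𝒞 i j → HE G 𝒞 j i
HE-sym G 𝒞 (p , inj₁ (x , a , b)) = (λ q → p (Relation.Binary.PropositionalEquality.sym q)) , inj₁ (x , b , a)
HE-sym G 𝒞 (p , inj₂ (x , y , a , b , e)) =
  (λ q → p (Relation.Binary.PropositionalEquality.sym q)) , inj₂ (y , x , b , a , Graph.sym G e)

H : (G : Graph) → Family G → Graph
H G 𝒞 = mkGraph (k 𝒞) (HE G 𝒞) (HE-sym G 𝒞) (λ { (p , _) → p refl })

{-# OPTIONS --safe #-}
-- Suppose J is an induced subgraph of H(G,𝒞) via a ↦ C(f a). Blow every vertex of G up into
-- |J| pairwise adjacent twins; the copies owned by a of the vertices of the connected set C(f a)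
-- are disjoint connected branch sets exhibiting J as an induced minor of the blow-up, which is
-- still J-free because J has no true twins. Contracting an edge inside a branch set preserves
-- both the induced-minor model and J-freeness, so after finitely many contractions every branch
-- set is a single vertex and the model is an induced copy of J in a J-free graph.
module Submission where

open import Defs hiding (sym)
open import Data.Nat using (ℕ; zero; suc; _*_)
open import Data.Fin using (Fin; zero; suc; punchIn; punchOut; combine; remQuot; _≟_)
open import Data.Fin.Properties
  using (punchIn-punchOut; punchInᵢ≢i; punchIn-injective; punchOut-injective; any?)
  using (remQuot-combine; combine-remQuot)
open import Data.Fin.Subset using (_∈_)
open import Data.Fin.Subset.Properties using (_∈?_)
open import Data.Maybe using (Maybe; just; nothing)
open import Data.Maybe.Properties using (just-injective; ≡-dec)
open import Data.Product using (∃-syntax; _×_; _,_; proj₁; proj₂; uncurry)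
open import Data.Sum using (_⊎_; inj₁; inj₂)
open import Data.Empty using (⊥-elim)
open import Relation.Nullary using (¬_; yes; no)
open import Relation.Nullary.Decidable using (¬?; _×-dec_)
open import Relation.Binary.PropositionalEquality
open import Function using (_⇔_; _∘_; mk⇔; Equivalence)
open import Function.Definitions using (Injective)

open Equivalence

data PathWithin (K : Graph) (P : Fin (n K) → Set) : Fin (n K) → Fin (n K) → Set where
  here : ∀ {x} → PathWithin K P x x
  step : ∀ {x y z} → E K x y → P y → PathWithin K P y z → PathWithin K P x z

-- J is an induced minor of K; vertices of K with branch nothing are deleted.
record InducedMinorModel (J K : Graph) : Set where
  field
    branch           : Fin (n K) → Maybe (Fin (n J))
    branch-nonempty  : ∀ a → ∃[ x ] branch x ≡ just a
    adjacent⇔        : ∀ a b → a ≢ b →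
      E J a b ⇔ (∃[ x ] ∃[ y ] (branch x ≡ just a × branch y ≡ just b × E K x y))
    branch-connected : ∀ a x y → branch x ≡ just a → branch y ≡ just a →
      PathWithin K (λ z → branch z ≡ just a) x y

open InducedMinorModel

module _ {J K : Graph} (M : InducedMinorModel J K) where

  SharedBranch : Set
  SharedBranch = ∃[ x ] ∃[ y ] ∃[ a ] (x ≢ y × branch M x ≡ just a × branch M y ≡ just a)

  SingletonBranches : Set
  SingletonBranches = ∀ x y a → branch M x ≡ just a → branch M y ≡ just a → x ≡ y

  shared⊎singletons : SharedBranch ⊎ SingletonBranches
  shared⊎singletons with any? (λ x → any? (λ y → any? (λ a →
    ¬? (x ≟ y) ×-dec ≡-dec _≟_ (branch M x) (just a) ×-dec ≡-dec _≟_ (branch M y) (just a))))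
  ... | yes shared = inj₁ shared
  ... | no ¬shared = inj₂ singletons
    where
    singletons : SingletonBranches
    singletons x y a bx by with x ≟ y
    ... | yes x≡y = x≡y
    ... | no x≢y  = ⊥-elim (¬shared (x , y , a , x≢y , bx , by))

  shared⇒edge-within-branch : SharedBranch → ∃[ x ] ∃[ y ] (E K x y × branch M x ≡ branch M y)
  shared⇒edge-within-branch (x , y , a , x≢y , bx , by) with branch-connected M a x y bx by
  ... | here                = ⊥-elim (x≢y refl)
  ... | step {y = z} e bz _ = x , z , e , trans bx (sym bz)

  singletons⇒induced : SingletonBranches → InducedSubgraph J K
  singletons⇒induced singletons = f , f-injective , f-iso
    where
    f : Fin (n J) → Fin (n K)
    f a = proj₁ (branch-nonempty M a)

    bf : ∀ a → branch M (f a) ≡ just a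
    bf a = proj₂ (branch-nonempty M a)

    f-injective : Injective _≡_ _≡_ f
    f-injective {a} {b} fa≡fb = just-injective (trans (sym (bf a)) (trans (cong (branch M) fa≡fb) (bf b)))

    f-iso : ∀ a b → E J a b ⇔ E K (f a) (f b)
    f-iso a b = mk⇔ forward backward
      where
      forward : E J a b → E K (f a) (f b)
      forward e with to (adjacent⇔ M a b (edge⇒≢ J e)) e
      ... | x , y , bx , by , exy =
        subst₂ (E K) (singletons x (f a) a bx (bf a)) (singletons y (f b) b by (bf b)) exy

      backward : E K (f a) (f b) → E J a b
      backward e = from (adjacent⇔ M a b (edge⇒≢ K e ∘ cong f)) (f a , f b , bf a , bf b , e)

module Contraction (m : ℕ) (E₀ : Fin (suc (suc m)) → Fin (suc (suc m)) → Set)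
  (sym₀ : ∀ {x y} → E₀ x y → E₀ y x) (irrefl₀ : ∀ {x} → ¬ E₀ x x)
  (u v : Fin (suc (suc m))) (u≢v : u ≢ v) where

  K : Graph
  K = mkGraph (suc (suc m)) E₀ sym₀ irrefl₀

  K/uv : Graph
  K/uv = contractAux m E₀ sym₀ irrefl₀ u v u≢v

  other : Fin m → Fin (suc (suc m))
  other = rest m E₀ sym₀ u v u≢v

  other≢u : ∀ i → other i ≢ u
  other≢u i = punchInᵢ≢i u _

  other≢v : ∀ i → other i ≢ v
  other≢v i eq = punchInᵢ≢i (punchOut u≢v) i
    (punchIn-injective u _ _ (trans eq (sym (punchIn-punchOut u≢v))))

  other-injective : Injective _≡_ _≡_ other
  other-injective eq = punchIn-injective (punchOut u≢v) _ _ (punchIn-injective u _ _ eq)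

  other-onto : ∀ {x} → x ≢ u → x ≢ v → ∃[ i ] other i ≡ x
  other-onto {x} x≢u x≢v = punchOut w≢x′ , (begin
      punchIn u (punchIn (punchOut u≢v) (punchOut w≢x′)) ≡⟨ cong (punchIn u) (punchIn-punchOut w≢x′) ⟩
      punchIn u x′                                        ≡⟨ punchIn-punchOut (x≢u ∘ sym) ⟩
      x                                                   ∎)
    where
    open ≡-Reasoning
    x′ : Fin (suc m)
    x′ = punchOut (x≢u ∘ sym)
    w≢x′ : punchOut u≢v ≢ x′
    w≢x′ eq = x≢v (sym (punchOut-injective u≢v (x≢u ∘ sym) eq))

  data Position (x : Fin (suc (suc m))) : Set where
    at-u     : x ≡ u → Position x
    at-v     : x ≡ v → Position x
    at-other : ∀ i → other i ≡ x → Position x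

  position : ∀ x → Position x
  position x with x ≟ u | x ≟ v
  ... | yes x≡u | _       = at-u x≡u
  ... | no _    | yes x≡v = at-v x≡v
  ... | no x≢u  | no x≢v  = uncurry at-other (other-onto x≢u x≢v)

  collapseAt : ∀ {x} → Position x → Fin (suc m)
  collapseAt (at-u _)       = zero
  collapseAt (at-v _)       = zero
  collapseAt (at-other i _) = suc i

  collapse : Fin (suc (suc m)) → Fin (suc m)
  collapse x = collapseAt (position x)

  expand : Fin (suc m) → Fin (suc (suc m))
  expand zero    = u
  expand (suc i) = other i

  collapse-u : collapse u ≡ zero
  collapse-u with position u
  ... | at-u _       = refl
  ... | at-v _       = refl
  ... | at-other i e = ⊥-elim (other≢u i e)

  collapse-v : collapse v ≡ zero
  collapse-v with position v
  ... | at-u _       = refl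
  ... | at-v _       = refl
  ... | at-other i e = ⊥-elim (other≢v i e)

  collapse-other : ∀ i → collapse (other i) ≡ suc i
  collapse-other i with position (other i)
  ... | at-u e       = ⊥-elim (other≢u i e)
  ... | at-v e       = ⊥-elim (other≢v i e)
  ... | at-other j e = cong suc (other-injective e)

  collapse-expand : ∀ x → collapse (expand x) ≡ x
  collapse-expand zero    = collapse-u
  collapse-expand (suc i) = collapse-other i

  collapse-edge : ∀ x y → E₀ x y → collapse x ≡ collapse y ⊎ E K/uv (collapse x) (collapse y)
  collapse-edge x y e with position x | position y
  ... | at-u refl       | at-u refl       = inj₁ refl
  ... | at-u refl       | at-v refl       = inj₁ refl
  ... | at-v refl       | at-u refl       = inj₁ refl
  ... | at-v refl       | at-v refl       = inj₁ refl
  ... | at-u refl       | at-other j refl = inj₂ (inj₁ e)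
  ... | at-v refl       | at-other j refl = inj₂ (inj₂ e)
  ... | at-other i refl | at-u refl       = inj₂ (inj₁ (sym₀ e))
  ... | at-other i refl | at-v refl       = inj₂ (inj₂ (sym₀ e))
  ... | at-other i refl | at-other j refl = inj₂ e

  edge-lift : ∀ x′ y′ → E K/uv x′ y′ → ∃[ x ] ∃[ y ] (collapse x ≡ x′ × collapse y ≡ y′ × E₀ x y)
  edge-lift zero    zero    ()
  edge-lift zero    (suc j) (inj₁ e) = u , other j , collapse-u , collapse-other j , e
  edge-lift zero    (suc j) (inj₂ e) = v , other j , collapse-v , collapse-other j , e
  edge-lift (suc i) zero    (inj₁ e) = other i , u , collapse-other i , collapse-u , sym₀ e
  edge-lift (suc i) zero    (inj₂ e) = other i , v , collapse-other i , collapse-v , sym₀ e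
  edge-lift (suc i) (suc j) e        = other i , other j , collapse-other i , collapse-other j , e

  module _ {J : Graph} (M : InducedMinorModel J K) (u∼v : branch M u ≡ branch M v) where

    branch-collapse : ∀ x → branch M (expand (collapse x)) ≡ branch M x
    branch-collapse x with position x
    ... | at-u refl       = refl
    ... | at-v refl       = u∼v
    ... | at-other i refl = refl

    collapse-same-branch : ∀ {x y} → collapse x ≡ collapse y → branch M x ≡ branch M y
    collapse-same-branch {x} {y} x∼y = begin
      branch M x                     ≡⟨ sym (branch-collapse x) ⟩
      branch M (expand (collapse x)) ≡⟨ cong (branch M ∘ expand) x∼y ⟩
      branch M (expand (collapse y)) ≡⟨ branch-collapse y ⟩
      branch M y                     ∎
      where open ≡-Reasoning

    collapse-path : ∀ {a x y} → PathWithin K (λ z → branch M z ≡ just a) x y →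
      PathWithin K/uv (λ z → branch M (expand z) ≡ just a) (collapse x) (collapse y)
    collapse-path here = here
    collapse-path (step {x} {y} e by p) with collapse-edge x y e
    ... | inj₁ x∼y = subst (λ t → PathWithin K/uv _ t _) (sym x∼y) (collapse-path p)
    ... | inj₂ e′  = step e′ (trans (branch-collapse y) by) (collapse-path p)

    contract-model : InducedMinorModel J K/uv
    contract-model .branch = branch M ∘ expand
    contract-model .branch-nonempty a with branch-nonempty M a
    ... | x , bx = collapse x , trans (branch-collapse x) bx
    contract-model .adjacent⇔ a b a≢b = mk⇔ forward backward
      where
      forward : E J a b → _
      forward e with to (adjacent⇔ M a b a≢b) e
      ... | x , y , bx , by , exy with collapse-edge x y exy
      ...   | inj₁ x∼y = ⊥-elim (a≢b (just-injective (trans (sym bx) (trans (collapse-same-branch x∼y) by))))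
      ...   | inj₂ e′  =
        collapse x , collapse y , trans (branch-collapse x) bx , trans (branch-collapse y) by , e′
      backward : _ → E J a b
      backward (x′ , y′ , bx′ , by′ , e′) with edge-lift x′ y′ e′
      ... | x , y , refl , refl , exy =
        from (adjacent⇔ M a b a≢b)
          (x , y , trans (sym (branch-collapse x)) bx′ , trans (sym (branch-collapse y)) by′ , exy)
    contract-model .branch-connected a x y bx by =
      subst₂ (PathWithin K/uv _) (collapse-expand x) (collapse-expand y)
        (collapse-path (branch-connected M a (expand x) (expand y) bx by))

module _ {J : Graph} (closed : FreeClosedUnderContraction J) where

  -- Stated for a graph in constructor form, so that Contract computes and the recursion is on N.
  free⇒¬model′ : ∀ N E₀ (sym₀ : ∀ {x y} → E₀ x y → E₀ y x) (irrefl₀ : ∀ {x} → ¬ E₀ x x) →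
    let K = mkGraph N E₀ sym₀ irrefl₀ in Free J K → ¬ InducedMinorModel J K
  free⇒¬model′ N E₀ sym₀ irrefl₀ free M with shared⊎singletons M
  ... | inj₂ singletons = free (singletons⇒induced M singletons)
  ... | inj₁ shared with shared⇒edge-within-branch M shared
  free⇒¬model′ (suc zero) E₀ sym₀ irrefl₀ free M | inj₁ _ | zero , zero , e , _ = irrefl₀ e
  free⇒¬model′ (suc (suc m)) E₀ sym₀ irrefl₀ free M | inj₁ _ | u , v , e , u∼v =
    free⇒¬model′ (suc m) _ _ _ (closed K free u v e) (contract-model M u∼v)
    where
    K = mkGraph (suc (suc m)) E₀ sym₀ irrefl₀
    open Contraction m E₀ sym₀ irrefl₀ u v (edge⇒≢ K e) using (contract-model)

  free⇒¬model : ∀ {K} → Free J K → ¬ InducedMinorModel J K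
  free⇒¬model {K} = free⇒¬model′ (n K) (E K) (Graph.sym K) (irrefl K)

module _ (G : Graph) {N : ℕ} (p : Fin N → Fin (n G)) where

  BlowupEdge : Fin N → Fin N → Set
  BlowupEdge x y = x ≢ y × (p x ≡ p y ⊎ E G (p x) (p y))

  BlowupEdge-sym : ∀ {x y} → BlowupEdge x y → BlowupEdge y x
  BlowupEdge-sym (x≢y , inj₁ px≡py) = x≢y ∘ sym , inj₁ (sym px≡py)
  BlowupEdge-sym (x≢y , inj₂ e)     = x≢y ∘ sym , inj₂ (Graph.sym G e)

  Blowup : Graph
  Blowup = mkGraph N BlowupEdge BlowupEdge-sym (λ (x≢x , _) → x≢x refl)

  -- Vertices of Blowup with the same image under p are true twins, so an induced J
  -- without true twins meets each fibre at most once and projects to an induced J in G.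
  blowup-free : ∀ {J} → NoTrueTwins J → Free J G → Free J Blowup
  blowup-free {J} noTwins G-free (g , g-injective , g-iso) = G-free (h , h-injective , h-iso)
    where
    h : Fin (n J) → Fin (n G)
    h = p ∘ g

    transfer : ∀ {a b c} → b ≢ c → h a ≡ h b → E J a c → E J b c
    transfer {a} {b} {c} b≢c ha≡hb e with to (g-iso a c) e
    ... | _ , adj = from (g-iso b c) (b≢c ∘ g-injective , subst (λ t → t ≡ h c ⊎ E G t (h c)) ha≡hb adj)

    h-injective : Injective _≡_ _≡_ h
    h-injective {a} {b} ha≡hb with a ≟ b
    ... | yes a≡b = a≡b
    ... | no a≢b  = ⊥-elim (noTwins a b (a∼b , twins))
      where
      a∼b : E J a b
      a∼b = from (g-iso a b) (a≢b ∘ g-injective , inj₁ ha≡hb)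
      twins : ∀ c → c ≢ a → c ≢ b → E J a c ⇔ E J b c
      twins c c≢a c≢b = mk⇔ (transfer (c≢b ∘ sym) ha≡hb) (transfer (c≢a ∘ sym) (sym ha≡hb))

    h-iso : ∀ a b → E J a b ⇔ E G (h a) (h b)
    h-iso a b = mk⇔ forward backward
      where
      forward : E J a b → E G (h a) (h b)
      forward e with to (g-iso a b) e
      ... | _ , inj₁ ha≡hb = ⊥-elim (edge⇒≢ J e (h-injective ha≡hb))
      ... | _ , inj₂ e′    = e′
      backward : E G (h a) (h b) → E J a b
      backward e = from (g-iso a b) ((λ ga≡gb → irrefl G (subst (E G (h a) ∘ p) (sym ga≡gb) e)) , inj₂ e)

module _ (G J : Graph) where

  owner : Fin (n J * n G) → Fin (n J)
  owner z = proj₁ (remQuot {n J} (n G) z)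

  original : Fin (n J * n G) → Fin (n G)
  original z = proj₂ (remQuot {n J} (n G) z)

  copy : Fin (n J) → Fin (n G) → Fin (n J * n G)
  copy = combine

  owner-copy : ∀ a x → owner (copy a x) ≡ a
  owner-copy a x = cong proj₁ (remQuot-combine {n J} {n G} a x)

  original-copy : ∀ a x → original (copy a x) ≡ x
  original-copy a x = cong proj₂ (remQuot-combine {n J} {n G} a x)

  copy-owner-original : ∀ z → copy (owner z) (original z) ≡ z
  copy-owner-original = combine-remQuot {n J} (n G)

  copy-injectiveˡ : ∀ {a b x y} → copy a x ≡ copy b y → a ≡ b
  copy-injectiveˡ {a} {b} {x} {y} eq =
    trans (sym (owner-copy a x)) (trans (cong owner eq) (owner-copy b y))

  copy-injectiveʳ : ∀ {a b x y} → copy a x ≡ copy b y → x ≡ y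
  copy-injectiveʳ {a} {b} {x} {y} eq =
    trans (sym (original-copy a x)) (trans (cong original eq) (original-copy b y))

  copies-adjacent : ∀ {a b x y} → copy a x ≢ copy b y → x ≡ y ⊎ E G x y →
    E (Blowup G original) (copy a x) (copy b y)
  copies-adjacent {a} {b} {x} {y} ax≢by adj =
    ax≢by , subst₂ (λ s t → s ≡ t ⊎ E G s t) (sym (original-copy a x)) (sym (original-copy b y)) adj

  module _ (𝒞 : Family G) (f : Fin (n J) → Fin (k 𝒞)) where

    copyBranch : Fin (n J * n G) → Maybe (Fin (n J))
    copyBranch z with original z ∈? C 𝒞 (f (owner z))
    ... | yes _ = just (owner z)
    ... | no _  = nothing

    copyBranch-copy : ∀ {a x} → x ∈ C 𝒞 (f a) → copyBranch (copy a x) ≡ just a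
    copyBranch-copy {a} {x} x∈Ca with original (copy a x) ∈? C 𝒞 (f (owner (copy a x)))
    ... | yes _ = cong just (owner-copy a x)
    ... | no x∉  =
      ⊥-elim (x∉ (subst₂ (λ y b → y ∈ C 𝒞 (f b)) (sym (original-copy a x)) (sym (owner-copy a x)) x∈Ca))

    copyBranch⇒copy : ∀ {z a} → copyBranch z ≡ just a → copy a (original z) ≡ z × original z ∈ C 𝒞 (f a)
    copyBranch⇒copy {z} bz with original z ∈? C 𝒞 (f (owner z))
    copyBranch⇒copy {z} refl | yes z∈ = copy-owner-original z , z∈

    reach⇒path : ∀ {a x y} → Reach G (C 𝒞 (f a)) x y →
      PathWithin (Blowup G original) (λ z → copyBranch z ≡ just a) (copy a x) (copy a y)
    reach⇒path here                = here
    reach⇒path (step e y∈Ca reach) =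
      step (copies-adjacent (edge⇒≢ G e ∘ copy-injectiveʳ) (inj₂ e)) (copyBranch-copy y∈Ca) (reach⇒path reach)

  H-embedding⇒blowup-model : (𝒞 : Family G) →
    InducedSubgraph J (H G 𝒞) → InducedMinorModel J (Blowup G original)
  H-embedding⇒blowup-model 𝒞 (f , f-injective , f-iso) = model
    where
    model : InducedMinorModel J (Blowup G original)
    model .branch = copyBranch 𝒞 f
    model .branch-nonempty a with proj₁ (conn 𝒞 (f a))
    ... | x , x∈Ca = copy a x , copyBranch-copy 𝒞 f x∈Ca
    model .adjacent⇔ a b a≢b = mk⇔ forward backward
      where
      forward : E J a b → _
      forward e with proj₂ (to (f-iso a b) e)
      ... | inj₁ (x , x∈Ca , x∈Cb) =
        copy a x , copy b x , copyBranch-copy 𝒞 f x∈Ca , copyBranch-copy 𝒞 f x∈Cb ,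
        copies-adjacent (a≢b ∘ copy-injectiveˡ) (inj₁ refl)
      ... | inj₂ (x , y , x∈Ca , y∈Cb , exy) =
        copy a x , copy b y , copyBranch-copy 𝒞 f x∈Ca , copyBranch-copy 𝒞 f y∈Cb ,
        copies-adjacent (a≢b ∘ copy-injectiveˡ) (inj₂ exy)
      backward : _ → E J a b
      backward (z , w , bz , bw , (_ , adj)) with copyBranch⇒copy 𝒞 f bz | copyBranch⇒copy 𝒞 f bw
      ... | _ , z∈Ca | _ , w∈Cb = from (f-iso a b) (a≢b ∘ f-injective , H-adjacency adj)
        where
        H-adjacency : original z ≡ original w ⊎ E G (original z) (original w) → _
        H-adjacency (inj₁ z∼w) = inj₁ (original z , z∈Ca , subst (λ t → t ∈ C 𝒞 (f b)) (sym z∼w) w∈Cb)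
        H-adjacency (inj₂ e)   = inj₂ (original z , original w , z∈Ca , w∈Cb , e)
    model .branch-connected a z w bz bw with copyBranch⇒copy 𝒞 f bz | copyBranch⇒copy 𝒞 f bw
    ... | z≡ , z∈Ca | w≡ , w∈Ca =
      subst₂ (PathWithin (Blowup G original) _) z≡ w≡
        (reach⇒path 𝒞 f (proj₂ (conn 𝒞 (f a)) _ _ z∈Ca w∈Ca))

lemma2p3 : (G J : Graph) (𝒞 : Family G)
    → Free J G
    → NoTrueTwins J
    → FreeClosedUnderContraction J
    → Free J (H G 𝒞)
lemma2p3 G J 𝒞 G-free noTwins closed J⊆H =
  free⇒¬model closed
    (blowup-free G (original G J) {J} noTwins G-free)
    (H-embedding⇒blowup-model G J 𝒞 J⊆H)
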